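{- Let $D=1$, $A\ge2$, and $k\ge1$ an integer. Let $N=n_\lambda\dots n_0$ and $N'=n'_\lambda\dots n'_0$ be digit strings with digits in $\{ -1,0,1\}$ and let $1\le i$ with $i+k\le\lambda$. If $n_{i+k}\dots n_i=01^k$ (i.e. $n_{i+k}=0$ and $n_{i}=\dots=n_{i+k-1}=1$), $n'_{i+k}\dots n'_i=10^k$ (i.e. $n'_{i+k}=1$ and $n'_i=\dots=n'_{i+k-1}=0$), and $\delta(N,i-1)\ge\delta(N',i-1)\ge2$, then $\delta(N,i+k)\ge\delta(N',i+k)\ge2$.
   Context: Time model with doubling time $D$ and addition time $A$: for a digit string $N=n_\lambda\dots n_0$, define recursively for $0\le i\le\lambda$: $T(N,i)=0$ if $i=0$ and $n_0=0$; $T(N,i)=T(N,i-1)$ if $i>0$ and $n_i=0$; $T(N,i)=iD+(|n_i|-1)A$ if $n_i\ne0$ and $n_j=0$ for all $0\le j<i$; and $T(N,i)=\max(T(N,i-1),iD)+|n_i|A$ otherwise. With $D=1$, the delay is $\delta(N,i)=T(N,i)-i$.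
   Formalization: The addition time A is taken to be rational rather than real. -}

module Defs where

open import Data.Nat using (ℕ; zero; suc)
open import Data.Integer using (+_)
open import Data.Bool using (Bool; true; false; _∧_; if_then_else_)
open import Data.Rational using (ℚ; 0ℚ; 1ℚ; _+_; _-_; _*_; _⊔_; _/_)

data Digit : Set where
  m1 z p1 : Digit

absD : Digit → ℚ
absD m1 = 1ℚ
absD z  = 0ℚ
absD p1 = 1ℚ

isZero : Digit → Bool
isZero z = true
isZero _ = false

-- A digit string N = n_λ … n_0 is given by its digit function (index j ↦ n_j);
-- only the digits with index ≤ λ are ever consulted.
DigitString : Set
DigitString = ℕ → Digit

ℕ→ℚ : ℕ → ℚ
ℕ→ℚ n = + n / 1

allZeroBelow : DigitString → ℕ → Bool
allZeroBelow N zero    = true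
allZeroBelow N (suc i) = allZeroBelow N i ∧ isZero (N i)

-- T(N,i) with doubling time D = 1 and addition time A
T : ℚ → DigitString → ℕ → ℚ
T A N zero with N zero
... | z  = 0ℚ
... | d  = ℕ→ℚ 0 + (absD d - 1ℚ) * A
T A N (suc i) with N (suc i)
... | z = T A N i
... | d = if allZeroBelow N (suc i)
           then ℕ→ℚ (suc i) + (absD d - 1ℚ) * A
           else (T A N i ⊔ ℕ→ℚ (suc i)) + absD d * A

δ : ℚ → DigitString → ℕ → ℚ
δ A N i = T A N i - ℕ→ℚ i

-- Along the block the zeros of N' leave T unchanged, so its final 1 gives
-- T(N', i+k) = max(T(N', i-1), i+k) + A, while the ones of N make T grow by A and
-- then by at least 1 per digit: T(N, i+k) ≥ T(N, i-1) + A + (k-1). The maximum is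
-- dominated because T(N', i-1) ≤ T(N, i-1) and δ(N', i-1) ≥ 2 gives
-- i+k ≤ T(N', i-1) + k - 1; and δ(N', i+k) ≥ A ≥ 2 since the maximum is at least i+k.
-- A positive delay also forces a nonzero digit at or below i-1, so that T is always
-- computed by its max-clause and never by its "first nonzero digit" clause.
module Submission where

open import Defs
open import Data.Nat using (ℕ; _+_; _∸_; _<_; _≤_)
open import Data.Rational using (ℚ) renaming (_≤_ to _≤ℚ_)
open import Data.Product using (_×_)
open import Relation.Binary.PropositionalEquality using (_≡_)

open import Algebra.Bundles using (AbelianGroup)
open import Data.Bool using (true; false)
open import Data.Bool.Properties using (∧-conicalˡ; ∧-conicalʳ)
open import Data.Integer as ℤ using (+_)
import Data.Integer.Properties as ℤ
open import Data.Nat using (suc; zero; z≤n; s≤s; _≤′_; ≤′-refl; ≤′-step)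
import Data.Nat.Properties as ℕ
open import Data.Nat.Coprimality using (1-coprimeTo) renaming (sym to coprime-sym)
open import Data.Product using (_,_)
open import Data.Rational
  using (mkℚ; 0ℚ; 1ℚ; -_; _⊔_; *≤*; *<*) renaming (_+_ to _+ℚ_; _-_ to _-ℚ_; _<_ to _<ℚ_)
open import Data.Rational.Properties
  using ( normalize-coprime; toℚᵘ-injective; toℚᵘ-homo-+; +-0-abelianGroup
        ; +-mono-≤; +-monoˡ-≤; +-monoʳ-≤; ≤-trans; <-≤-trans; <-irrefl
        ; p≤p⊔q; p≤q⊔p; ⊔-lub; neg-antimono-≤; *-identityˡ; +-identityʳ; +-identityˡ
        ; module ≤-Reasoning )
open import Algebra.Properties.AbelianGroup +-0-abelianGroup
  using (//-rightDividesˡ; xyx⁻¹≈y)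
open import Algebra.Properties.CommutativeSemigroup
  (AbelianGroup.commutativeSemigroup +-0-abelianGroup)
  using (xy∙z≈xz∙y; x∙yz≈xz∙y)
import Data.Rational.Unnormalised as ℚᵘ
import Data.Rational.Unnormalised.Properties as ℚᵘ
open import Relation.Binary.PropositionalEquality
  using (refl; sym; trans; cong; cong₂; subst; subst₂; module ≡-Reasoning)
open import Relation.Nullary using (contradiction)

ℕ→ℚ≡mkℚ : ∀ n → ℕ→ℚ n ≡ mkℚ (+ n) 0 (coprime-sym (1-coprimeTo n))
ℕ→ℚ≡mkℚ n = normalize-coprime (coprime-sym (1-coprimeTo n))

ℕ→ℚ-+ : ∀ m n → ℕ→ℚ (m + n) ≡ ℕ→ℚ m +ℚ ℕ→ℚ n
ℕ→ℚ-+ m n rewrite ℕ→ℚ≡mkℚ m | ℕ→ℚ≡mkℚ n | ℕ→ℚ≡mkℚ (m + n) =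
  toℚᵘ-injective (ℚᵘ.≃-trans (ℚᵘ.*≡* cross-multiplied) (ℚᵘ.≃-sym (toℚᵘ-homo-+ m/1 n/1)))
  where
  open ≡-Reasoning
  m/1 = mkℚ (+ m) 0 (coprime-sym (1-coprimeTo m))
  n/1 = mkℚ (+ n) 0 (coprime-sym (1-coprimeTo n))
  cross-multiplied : + (m + n) ℤ.* + 1 ≡ (+ m ℤ.* + 1 ℤ.+ + n ℤ.* + 1) ℤ.* + 1
  cross-multiplied = begin
    + (m + n) ℤ.* + 1                      ≡⟨ ℤ.*-identityʳ _ ⟩
    + m ℤ.+ + n                            ≡⟨ cong₂ ℤ._+_ (ℤ.*-identityʳ (+ m)) (ℤ.*-identityʳ (+ n)) ⟨
    + m ℤ.* + 1 ℤ.+ + n ℤ.* + 1            ≡⟨ ℤ.*-identityʳ _ ⟨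
    (+ m ℤ.* + 1 ℤ.+ + n ℤ.* + 1) ℤ.* + 1  ∎

ℕ→ℚ-mono-≤ : ∀ {m n} → m ≤ n → ℕ→ℚ m ≤ℚ ℕ→ℚ n
ℕ→ℚ-mono-≤ {m} {n} m≤n rewrite ℕ→ℚ≡mkℚ m | ℕ→ℚ≡mkℚ n =
  *≤* (subst₂ ℤ._≤_ (sym (ℤ.*-identityʳ (+ m))) (sym (ℤ.*-identityʳ (+ n))) (ℤ.+≤+ m≤n))

p≤p+ℕ→ℚ : ∀ p n → p ≤ℚ p +ℚ ℕ→ℚ n
p≤p+ℕ→ℚ p n = subst (_≤ℚ p +ℚ ℕ→ℚ n) (+-identityʳ p) (+-monoʳ-≤ p (ℕ→ℚ-mono-≤ {0} {n} z≤n))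

p-r≤q-r⇒p≤q : ∀ {p q r} → p -ℚ r ≤ℚ q -ℚ r → p ≤ℚ q
p-r≤q-r⇒p≤q {p} {q} {r} le =
  subst₂ _≤ℚ_ (//-rightDividesˡ r p) (//-rightDividesˡ r q) (+-monoˡ-≤ r le)

p≤q-r⇒p+r≤q : ∀ {p q r} → p ≤ℚ q -ℚ r → p +ℚ r ≤ℚ q
p≤q-r⇒p+r≤q {p} {q} {r} le = subst (p +ℚ r ≤ℚ_) (//-rightDividesˡ r q) (+-monoˡ-≤ r le)

2≤δ⇒2+m≤T : ∀ {A N} m → ℕ→ℚ 2 ≤ℚ δ A N m → ℕ→ℚ (2 + m) ≤ℚ T A N m
2≤δ⇒2+m≤T {A} {N} m 2≤δ = subst (_≤ℚ T A N m) (sym (ℕ→ℚ-+ 2 m)) (p≤q-r⇒p+r≤q 2≤δ)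

allZeroBelow⇒T≡0 : ∀ {A N} m → allZeroBelow N (suc m) ≡ true → T A N m ≡ 0ℚ
allZeroBelow⇒T≡0 {N = N} zero e with N zero
... | z  = refl
... | m1 with () ← e
... | p1 with () ← e
allZeroBelow⇒T≡0 {N = N} (suc m) e with N (suc m)
... | z  = allZeroBelow⇒T≡0 m (∧-conicalˡ (allZeroBelow N (suc m)) true e)
... | m1 with () ← ∧-conicalʳ (allZeroBelow N (suc m)) false e
... | p1 with () ← ∧-conicalʳ (allZeroBelow N (suc m)) false e

0<δ⇒allZeroBelow≡false : ∀ {A N} m → 0ℚ <ℚ δ A N m → allZeroBelow N (suc m) ≡ false
0<δ⇒allZeroBelow≡false {A} {N} m 0<δ with allZeroBelow N (suc m) in eq
... | false = refl
... | true  = contradiction (<-≤-trans 0<δ δ≤0) (<-irrefl refl)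
  where
  δ≤0 : δ A N m ≤ℚ 0ℚ
  δ≤0 rewrite allZeroBelow⇒T≡0 {A} m eq | +-identityˡ (- ℕ→ℚ m) =
    neg-antimono-≤ (ℕ→ℚ-mono-≤ {0} {m} z≤n)

allZeroBelow≡false-mono : ∀ {N m n} → m ≤ n → allZeroBelow N m ≡ false → allZeroBelow N n ≡ false
allZeroBelow≡false-mono {N} m≤n = go (ℕ.≤⇒≤′ m≤n)
  where
  go : ∀ {m n} → m ≤′ n → allZeroBelow N m ≡ false → allZeroBelow N n ≡ false
  go ≤′-refl         e = e
  go (≤′-step m≤′n) e rewrite go m≤′n e = refl

T-zero-digit : ∀ {A} N m → N (suc m) ≡ z → T A N (suc m) ≡ T A N m
T-zero-digit N m e rewrite e = refl

T-one-digit : ∀ {A} N m → N (suc m) ≡ p1 → allZeroBelow N (suc m) ≡ false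
            → T A N (suc m) ≡ (T A N m ⊔ ℕ→ℚ (suc m)) +ℚ A
T-one-digit {A} N m e nz rewrite e | nz = cong ((T A N m ⊔ ℕ→ℚ (suc m)) +ℚ_) (*-identityˡ A)

T-zero-run : ∀ {A N} m k → (∀ j → j < k → N (suc (m + j)) ≡ z) → T A N (m + k) ≡ T A N m
T-zero-run {A} {N} m zero    zeros = cong (T A N) (ℕ.+-identityʳ m)
T-zero-run {A} {N} m (suc k) zeros = begin
  T A N (m + suc k)    ≡⟨ cong (T A N) (ℕ.+-suc m k) ⟩
  T A N (suc (m + k))  ≡⟨ T-zero-digit N (m + k) (zeros k (ℕ.n<1+n k)) ⟩
  T A N (m + k)        ≡⟨ T-zero-run m k (λ j j<k → zeros j (ℕ.m<n⇒m<1+n j<k)) ⟩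
  T A N m              ∎
  where open ≡-Reasoning

T-one-digit-≥ : ∀ {A} N m → N (suc m) ≡ p1 → allZeroBelow N (suc m) ≡ false
              → T A N m +ℚ A ≤ℚ T A N (suc m)
T-one-digit-≥ {A} N m one nz =
  subst (T A N m +ℚ A ≤ℚ_) (sym (T-one-digit N m one nz)) (+-monoˡ-≤ A (p≤p⊔q (T A N m) (ℕ→ℚ (suc m))))

T-one-run : ∀ {A} N m l → 1ℚ ≤ℚ A → allZeroBelow N (suc m) ≡ false
          → (∀ j → j ≤ l → N (suc (m + j)) ≡ p1)
          → T A N m +ℚ A +ℚ ℕ→ℚ l ≤ℚ T A N (suc (m + l))
T-one-run {A} N m zero 1≤A nz ones = begin
  T A N m +ℚ A +ℚ 0ℚ   ≡⟨ +-identityʳ _ ⟩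
  T A N m +ℚ A         ≤⟨ T-one-digit-≥ N m (subst (λ n → N (suc n) ≡ p1) (ℕ.+-identityʳ m) (ones 0 z≤n)) nz ⟩
  T A N (suc m)        ≡⟨ cong (λ n → T A N (suc n)) (ℕ.+-identityʳ m) ⟨
  T A N (suc (m + 0))  ∎
  where open ≤-Reasoning
T-one-run {A} N m (suc l) 1≤A nz ones = begin
  T A N m +ℚ A +ℚ ℕ→ℚ (suc l)         ≡⟨ cong (T A N m +ℚ A +ℚ_) (ℕ→ℚ-+ 1 l) ⟩
  T A N m +ℚ A +ℚ (1ℚ +ℚ ℕ→ℚ l)       ≡⟨ x∙yz≈xz∙y (T A N m +ℚ A) 1ℚ (ℕ→ℚ l) ⟩
  T A N m +ℚ A +ℚ ℕ→ℚ l +ℚ 1ℚ         ≤⟨ +-mono-≤ previous 1≤A ⟩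
  T A N (suc (m + l)) +ℚ A            ≤⟨ T-one-digit-≥ N (suc (m + l)) next nz′ ⟩
  T A N (suc (suc (m + l)))           ≡⟨ cong (λ n → T A N (suc n)) (ℕ.+-suc m l) ⟨
  T A N (suc (m + suc l))             ∎
  where
  open ≤-Reasoning
  previous : T A N m +ℚ A +ℚ ℕ→ℚ l ≤ℚ T A N (suc (m + l))
  previous = T-one-run N m l 1≤A nz (λ j j≤l → ones j (ℕ.m≤n⇒m≤1+n j≤l))
  next : N (suc (suc (m + l))) ≡ p1
  next = subst (λ n → N (suc n) ≡ p1) (ℕ.+-suc m l) (ones (suc l) ℕ.≤-refl)
  nz′ : allZeroBelow N (suc (suc (m + l))) ≡ false
  nz′ = allZeroBelow≡false-mono (s≤s (ℕ.m≤n⇒m≤1+n (ℕ.m≤m+n m l))) nz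

T-zeros-then-one : ∀ {A} N m k → allZeroBelow N (suc m) ≡ false
                 → (∀ j → j < k → N (suc (m + j)) ≡ z) → N (suc (m + k)) ≡ p1
                 → T A N (suc (m + k)) ≡ (T A N m ⊔ ℕ→ℚ (suc (m + k))) +ℚ A
T-zeros-then-one {A} N m k nz zeros one = begin
  T A N (suc (m + k))                        ≡⟨ T-one-digit N (m + k) one nz′ ⟩
  (T A N (m + k) ⊔ ℕ→ℚ (suc (m + k))) +ℚ A  ≡⟨ cong (λ t → (t ⊔ ℕ→ℚ (suc (m + k))) +ℚ A) (T-zero-run m k zeros) ⟩
  (T A N m ⊔ ℕ→ℚ (suc (m + k))) +ℚ A        ∎
  where
  open ≡-Reasoning
  nz′ : allZeroBelow N (suc (m + k)) ≡ false
  nz′ = allZeroBelow≡false-mono (s≤s (ℕ.m≤m+n m k)) nz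

T-ones-then-zero : ∀ {A} N m l → 1ℚ ≤ℚ A → allZeroBelow N (suc m) ≡ false
                 → (∀ j → j ≤ l → N (suc (m + j)) ≡ p1) → N (suc (m + suc l)) ≡ z
                 → T A N m +ℚ A +ℚ ℕ→ℚ l ≤ℚ T A N (suc (m + suc l))
T-ones-then-zero {A} N m l 1≤A nz ones zero′ = begin
  T A N m +ℚ A +ℚ ℕ→ℚ l    ≤⟨ T-one-run N m l 1≤A nz ones ⟩
  T A N (suc (m + l))      ≡⟨ cong (T A N) (ℕ.+-suc m l) ⟨
  T A N (m + suc l)        ≡⟨ T-zero-digit N (m + suc l) zero′ ⟨
  T A N (suc (m + suc l))  ∎
  where open ≤-Reasoning

lemma2 : (A : ℚ) → ℕ→ℚ 2 ≤ℚ A → (k : ℕ) → 1 ≤ k → (λ' : ℕ)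
       → (N N' : DigitString) → (i : ℕ) → 1 ≤ i → i + k ≤ λ'
       → N (i + k) ≡ z → (∀ j → j < k → N (i + j) ≡ p1)
       → N' (i + k) ≡ p1 → (∀ j → j < k → N' (i + j) ≡ z)
       → δ A N' (i ∸ 1) ≤ℚ δ A N (i ∸ 1) → ℕ→ℚ 2 ≤ℚ δ A N' (i ∸ 1)
       → δ A N' (i + k) ≤ℚ δ A N (i + k) × ℕ→ℚ 2 ≤ℚ δ A N' (i + k)
-- The length λ' is irrelevant: T(N, i+k) never consults digits above i+k.
lemma2 A 2≤A (suc k) _ _ N N' (suc a) _ _ zero-N ones-N one-N′ zeros-N′ δ′≤δ 2≤δ′ =
  +-monoˡ-≤ (- c) T′≤T , ≤-trans 2≤A A≤δ′
  where
  open ≤-Reasoning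
  t  = T A N a
  t′ = T A N' a
  c  = ℕ→ℚ (suc (a + suc k))
  0<2 : 0ℚ <ℚ ℕ→ℚ 2
  0<2 = *<* (ℤ.+<+ (s≤s z≤n))
  T′≡ : T A N' (suc (a + suc k)) ≡ (t′ ⊔ c) +ℚ A
  T′≡ = T-zeros-then-one N' a (suc k) (0<δ⇒allZeroBelow≡false a (<-≤-trans 0<2 2≤δ′)) zeros-N′ one-N′
  T≥ : t +ℚ A +ℚ ℕ→ℚ k ≤ℚ T A N (suc (a + suc k))
  T≥ = T-ones-then-zero N a k (≤-trans (ℕ→ℚ-mono-≤ {1} {2} (s≤s z≤n)) 2≤A)
         (0<δ⇒allZeroBelow≡false a (<-≤-trans 0<2 (≤-trans 2≤δ′ δ′≤δ)))
         (λ j j≤k → ones-N j (s≤s j≤k)) zero-N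
  t′≤t : t′ ≤ℚ t
  t′≤t = p-r≤q-r⇒p≤q δ′≤δ
  c≤t+k : c ≤ℚ t +ℚ ℕ→ℚ k
  c≤t+k = subst (_≤ℚ t +ℚ ℕ→ℚ k)
            (sym (trans (cong (λ n → ℕ→ℚ (suc n)) (ℕ.+-suc a k)) (ℕ→ℚ-+ (2 + a) k)))
            (+-monoˡ-≤ (ℕ→ℚ k) (≤-trans (2≤δ⇒2+m≤T a 2≤δ′) t′≤t))
  T′≤T : T A N' (suc (a + suc k)) ≤ℚ T A N (suc (a + suc k))
  T′≤T = begin
    T A N' (suc (a + suc k))  ≡⟨ T′≡ ⟩
    (t′ ⊔ c) +ℚ A             ≤⟨ +-monoˡ-≤ A (⊔-lub (≤-trans t′≤t (p≤p+ℕ→ℚ t k)) c≤t+k) ⟩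
    t +ℚ ℕ→ℚ k +ℚ A           ≡⟨ xy∙z≈xz∙y t (ℕ→ℚ k) A ⟩
    t +ℚ A +ℚ ℕ→ℚ k           ≤⟨ T≥ ⟩
    T A N (suc (a + suc k))   ∎
  A≤δ′ : A ≤ℚ δ A N' (suc (a + suc k))
  A≤δ′ = begin
    A                         ≡⟨ xyx⁻¹≈y c A ⟨
    c +ℚ A -ℚ c               ≤⟨ +-monoˡ-≤ (- c) (+-monoˡ-≤ A (p≤q⊔p t′ c)) ⟩
    (t′ ⊔ c) +ℚ A -ℚ c        ≡⟨ cong (_-ℚ c) T′≡ ⟨
    δ A N' (suc (a + suc k))  ∎
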